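{- The number of vectors $v\in\mathbb{N}^{2n-1}$ satisfying (i) $\|v\|_1\le n$, (ii) $v_1=0\implies v_2=v_3=\cdots=v_{2n-1}=0$, (iii) for every $i\in\{1,\ldots,n-2\}$: $v_{2i}=v_{2i+1}=0\implies v_{2i+2}=v_{2i+3}=\cdots=v_{2n-1}=0$, is $O(n(2+\sqrt{2})^n)$.
   Context: $\mathbb{N}=\{0,1,2,\ldots\}$ and $\|v\|_1=\sum_i v_i$ for $v\in\mathbb{N}^{2n-1}$. -}

module Defs where

open import Data.Nat using (ℕ; zero; suc; _+_; _*_; _∸_; _≤_)
open import Data.Vec using (Vec; []; _∷_; sum)
open import Data.Product using (_×_; _,_; proj₁; proj₂)
open import Relation.Binary.PropositionalEquality using (_≡_)

-- 1-based access: at v j = v_j for 1 ≤ j ≤ m (value 0 outside that range,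
-- never used by the conditions below since all indices are in range).
at : ∀ {m} → Vec ℕ m → ℕ → ℕ
at []       _             = 0
at (x ∷ xs) zero          = 0
at (x ∷ xs) (suc zero)    = x
at (x ∷ xs) (suc (suc j)) = at xs (suc j)

dim : ℕ → ℕ
dim n = 2 * n ∸ 1

ZeroFrom : (n : ℕ) → Vec ℕ (dim n) → ℕ → Set
ZeroFrom n v a = ∀ j → a ≤ j → j ≤ dim n → at v j ≡ 0

Good : (n : ℕ) → Vec ℕ (dim n) → Set
Good n v =
  (sum v ≤ n) ×
  ((at v 1 ≡ 0 → ZeroFrom n v 2) ×
   (∀ i → 1 ≤ i → i ≤ n ∸ 2 →
      at v (2 * i) ≡ 0 → at v (2 * i + 1) ≡ 0 → ZeroFrom n v (2 * i + 2)))

-- (2 + √2)^n = fst + snd · √2 with fst, snd ∈ ℕ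
pow2+√2 : ℕ → ℕ × ℕ
pow2+√2 zero    = 1 , 0
pow2+√2 (suc n) = let (a , b) = pow2+√2 n in (2 * a + 2 * b , a + 2 * b)

-- x ≤ y·√2 for natural x, y  (⇔ x² ≤ 2y²)
_≤√2*_ : ℕ → ℕ → Set
x ≤√2* y = x * x ≤ 2 * (y * y)

-- x ≤ c · (2+√2)^n  where c ∈ ℕ, i.e. x ≤ c·a + c·b·√2 with (a,b) = pow2+√2 n,
-- equivalently (x ∸ c·a) ≤ (c·b)·√2.
≤*pow2+√2 : ℕ → ℕ → ℕ → Set
≤*pow2+√2 x c n = (x ∸ c * proj₁ (pow2+√2 n)) ≤√2* (c * proj₂ (pow2+√2 n))

module Submission where

-- Write n = m + 1 and (2+√2)^s = α s + β s·√2.  We prove that the number of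
-- good vectors is at most 4n·α n; since α n ≤ (2+√2)^n this gives the
-- O(n(2+√2)^n) bound with C = 4.
--
-- A good vector v = (v₁, v₂, …, v_{2n-1}) is read as a first entry v₁ ≤ n
-- followed by the m pairs (v₂,v₃), …, (v_{2n-2},v_{2n-1}).  Condition (iii)
-- says that these pairs form a *chain*: nonzero pairs, possibly followed by
-- an all-zero tail.
--
-- 1. Counting principle: a duplicate-free list all of whose elements lie in
--    a list E is no longer than E.
-- 2. Chains of k pairs with sum ≤ s are enumerated by an explicit list of
--    length ≤ α s + β s, independently of k.  The enumeration splits off the
--    first pair by decreasing one of its two coordinates, so its size obeys
--    the linear recurrence (α, β) ↦ (2α + 2β, α + 2β) of (2+√2)^s.
-- 3. Condition (iii), transported from the vector to the list of its pairs,
--    makes that list a chain.  Hence every good vector lies in the list of all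
--    x ∷ w  with x ≤ n and w a chain of m pairs with sum ≤ n, whose length is
--    at most (n+1)(α n + β n) ≤ 4n·α n; by 1 this bounds the count.

open import Defs
open import Data.Nat using (ℕ; _*_; _≤_)
open import Data.Vec using (Vec)
open import Data.List using (List; length)
open import Data.List.Relation.Unary.Unique.Propositional using (Unique)
open import Data.List.Membership.Propositional using (_∈_)
open import Data.Product using (∃; _×_)
open import Function.Bundles using (_⇔_)

open import Data.Nat using (zero; suc; _+_; _∸_; _<_; z≤n; s≤s)
open import Data.Nat.Properties
open import Data.Nat.Tactic.RingSolver using (solve-∀)
open import Data.Vec as Vec using (toList)
import Data.Vec.Properties as VecProperties
open import Data.List using ([]; _∷_; map; _++_; drop; upTo; cartesianProductWith)
open import Data.Nat.ListAction using (sum)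
open import Data.List.Properties using (length-++; length-map; length-upTo; length-removeAt′)
open import Data.List.Membership.Propositional using (_─_)
open import Data.List.Membership.Propositional.Properties
  using (∈-map⁺; ∈-map⁻; ∈-++⁺ˡ; ∈-++⁺ʳ; ∈-upTo⁺)
open import Data.List.Relation.Unary.Any using (here; there; index)
open import Data.List.Relation.Unary.Any.Properties using (cartesianProductWith⁺)
open import Data.List.Relation.Unary.All as All using ()
open import Data.List.Relation.Unary.AllPairs using (_∷_)
import Data.List.Relation.Unary.Unique.Propositional.Properties as Unique
open import Data.Product using (_,_; proj₁; proj₂)
open import Data.Empty using (⊥-elim)
open import Function.Bundles using (Equivalence)
open import Relation.Nullary using (yes; no)
open import Relation.Binary.PropositionalEquality
  using (_≡_; _≢_; refl; sym; trans; cong; cong₂; subst; module ≡-Reasoning)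

α β : ℕ → ℕ
α s = proj₁ (pow2+√2 s)
β s = proj₂ (pow2+√2 s)

-- 1 ≤ α s accounts for the single chain of 0 pairs; β ≤ α lets the final
-- bound be stated with α alone.
1≤α : ∀ s → 1 ≤ α s
1≤α zero    = ≤-refl
1≤α (suc s) = ≤-trans (1≤α s) (≤-trans (m≤m+n (α s) (α s + 0)) (m≤m+n _ _))

β≤α : ∀ s → β s ≤ α s
β≤α zero    = z≤n
β≤α (suc s) = +-monoˡ-≤ (2 * β s) (m≤m+n (α s) (α s + 0))

-- Since β n·√2 ≥ 0, a bound by c·α n is a bound by c·(2+√2)^n.
≤*pow2+√2-from-α : ∀ x c n → x ≤ c * α n → ≤*pow2+√2 x c n
≤*pow2+√2-from-α x c n x≤cα =
  subst (λ d → d * d ≤ 2 * ((c * β n) * (c * β n))) (sym (m≤n⇒m∸n≡0 x≤cα)) z≤n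

length-map-++ : ∀ {a b} {A : Set a} {B : Set b} (f : A → B) xs ys →
                length (map f xs ++ ys) ≡ length xs + length ys
length-map-++ f xs ys = trans (length-++ (map f xs)) (cong (_+ length ys) (length-map f xs))

module _ {a} {A : Set a} where

  ∈-─ : ∀ {x z : A} {ys} (x∈ys : x ∈ ys) → z ∈ ys → x ≢ z → z ∈ ys ─ x∈ys
  ∈-─ (here refl) (here refl) x≢z = ⊥-elim (x≢z refl)
  ∈-─ (here refl) (there z∈ys) _  = z∈ys
  ∈-─ (there _)   (here refl)  _  = here refl
  ∈-─ (there x∈ys) (there z∈ys) x≢z = there (∈-─ x∈ys z∈ys x≢z)

  unique-⊆⇒length≤ : ∀ {xs ys : List A} → Unique xs → (∀ {z} → z ∈ xs → z ∈ ys) →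
                     length xs ≤ length ys
  unique-⊆⇒length≤ {[]}     _          _     = z≤n
  unique-⊆⇒length≤ {x ∷ xs} {ys} (x∉xs ∷ u) xs⊆ys = begin
    suc (length xs)           ≤⟨ s≤s (unique-⊆⇒length≤ u xs⊆ys─x) ⟩
    suc (length (ys ─ x∈ys))  ≡⟨ sym (length-removeAt′ ys (index x∈ys)) ⟩
    length ys                 ∎
    where
    open ≤-Reasoning
    x∈ys : x ∈ ys
    x∈ys = xs⊆ys (here refl)
    xs⊆ys─x : ∀ {z} → z ∈ xs → z ∈ ys ─ x∈ys
    xs⊆ys─x z∈xs = ∈-─ x∈ys (xs⊆ys (there z∈xs)) (All.lookup x∉xs z∈xs)

  length-cartesianProductWith : ∀ {B C : Set a} (f : A → B → C) xs ys →
    length (cartesianProductWith f xs ys) ≡ length xs * length ys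
  length-cartesianProductWith f []       ys = refl
  length-cartesianProductWith f (x ∷ xs) ys =
    trans (length-map-++ (f x) ys _) (cong (length ys +_) (length-cartesianProductWith f xs ys))

-- Chains of k pairs, written as flat lists of length 2k: a sequence of
-- nonzero pairs, possibly followed by an all-zero tail.
zeros : ℕ → List ℕ
zeros zero    = []
zeros (suc k) = 0 ∷ 0 ∷ zeros k

data Chain : ℕ → List ℕ → Set where
  done  : Chain 0 []
  stop  : ∀ {k} → Chain (suc k) (zeros (suc k))
  left  : ∀ {k a b r} → Chain k r → Chain (suc k) (suc a ∷ b ∷ r)
  right : ∀ {k b r} → Chain k r → Chain (suc k) (0 ∷ suc b ∷ r)

bumpFirst bumpSecond prepend00 : List ℕ → List ℕ
bumpFirst []      = []
bumpFirst (a ∷ r) = suc a ∷ r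
bumpSecond (a ∷ b ∷ r) = a ∷ suc b ∷ r
bumpSecond r           = r
prepend00 r = 0 ∷ 0 ∷ r

-- Enumerations, for chains r of k pairs and total sum ≤ s, of
--   chains k s        : the chains r themselves,
--   prefixed k s      : the lists  a ∷ b ∷ r  (an arbitrary first pair),
--   zeroPrefixed k s  : the lists  0 ∷ b ∷ r.
-- A nonzero first pair is enumerated by lowering a positive first coordinate
-- (prefixed) or, when that coordinate is 0, the second one (zeroPrefixed).
chains prefixed zeroPrefixed : ℕ → ℕ → List (List ℕ)
chains zero    s       = [] ∷ []
chains (suc k) zero    = zeros (suc k) ∷ []
chains (suc k) (suc s) =
  zeros (suc k) ∷ (map bumpFirst (prefixed k s) ++ map bumpSecond (zeroPrefixed k s))
prefixed k zero    = zeroPrefixed k zero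
prefixed k (suc s) = map bumpFirst (prefixed k s) ++ zeroPrefixed k (suc s)
zeroPrefixed k zero    = map prepend00 (chains k zero)
zeroPrefixed k (suc s) = map bumpSecond (zeroPrefixed k s) ++ map prepend00 (chains k (suc s))

chains-complete : ∀ {k w s} → Chain k w → sum w ≤ s → w ∈ chains k s
prefixed-complete : ∀ {k r} a b s → Chain k r → a + (b + sum r) ≤ s →
                    (a ∷ b ∷ r) ∈ prefixed k s
zeroPrefixed-complete : ∀ {k r} b s → Chain k r → b + sum r ≤ s →
                        (0 ∷ b ∷ r) ∈ zeroPrefixed k s
chains-complete done _ = here refl
chains-complete {s = zero}  stop _ = here refl
chains-complete {s = suc s} stop _ = here refl
chains-complete {s = suc s} (left {a = a} {b} c) (s≤s h) =
  there (∈-++⁺ˡ (∈-map⁺ bumpFirst (prefixed-complete a b s c h)))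
chains-complete {k = suc k} {s = suc s} (right {b = b} c) (s≤s h) =
  there (∈-++⁺ʳ (map bumpFirst (prefixed k s))
                (∈-map⁺ bumpSecond (zeroPrefixed-complete b s c h)))
prefixed-complete zero b zero c h = zeroPrefixed-complete b zero c h
prefixed-complete {k} zero b (suc s) c h =
  ∈-++⁺ʳ (map bumpFirst (prefixed k s)) (zeroPrefixed-complete b (suc s) c h)
prefixed-complete (suc a) b (suc s) c (s≤s h) =
  ∈-++⁺ˡ (∈-map⁺ bumpFirst (prefixed-complete a b s c h))
zeroPrefixed-complete zero zero c h = ∈-map⁺ prepend00 (chains-complete c h)
zeroPrefixed-complete {k} zero (suc s) c h =
  ∈-++⁺ʳ (map bumpSecond (zeroPrefixed k s)) (∈-map⁺ prepend00 (chains-complete c h))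
zeroPrefixed-complete (suc b) (suc s) c (s≤s h) =
  ∈-++⁺ˡ (∈-map⁺ bumpSecond (zeroPrefixed-complete b s c h))

-- Size bounds: the sizes satisfy the recurrence of (α, β), whatever k is.
length-chains : ∀ k s → length (chains k s) ≤ α s + β s
length-prefixed : ∀ k s → suc (length (prefixed k s)) ≤ α (suc s)
length-zeroPrefixed : ∀ k s → length (zeroPrefixed k s) ≤ β (suc s)
length-chains zero    s       = ≤-trans (1≤α s) (m≤m+n _ _)
length-chains (suc k) zero    = ≤-refl
length-chains (suc k) (suc s) = begin
  suc (length (map bumpFirst (prefixed k s) ++ map bumpSecond (zeroPrefixed k s)))
    ≡⟨ cong suc (length-map-++ bumpFirst (prefixed k s) _) ⟩
  suc (length (prefixed k s)) + length (map bumpSecond (zeroPrefixed k s))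
    ≡⟨ cong (suc (length (prefixed k s)) +_) (length-map bumpSecond (zeroPrefixed k s)) ⟩
  suc (length (prefixed k s)) + length (zeroPrefixed k s)
    ≤⟨ +-mono-≤ (length-prefixed k s) (length-zeroPrefixed k s) ⟩
  α (suc s) + β (suc s) ∎
  where open ≤-Reasoning
length-prefixed k zero = s≤s (length-zeroPrefixed k zero)
length-prefixed k (suc s) = begin
  suc (length (map bumpFirst (prefixed k s) ++ zeroPrefixed k (suc s)))
    ≡⟨ cong suc (length-map-++ bumpFirst (prefixed k s) _) ⟩
  suc (length (prefixed k s)) + length (zeroPrefixed k (suc s))
    ≤⟨ +-mono-≤ (length-prefixed k s) (length-zeroPrefixed k (suc s)) ⟩
  α (suc s) + β (suc (suc s))
    ≡⟨ step (α (suc s)) (β (suc s)) ⟩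
  α (suc (suc s)) ∎
  where
  open ≤-Reasoning
  step : ∀ a b → a + (a + 2 * b) ≡ 2 * a + 2 * b
  step = solve-∀
length-zeroPrefixed k zero = begin
  length (map prepend00 (chains k zero)) ≡⟨ length-map prepend00 (chains k zero) ⟩
  length (chains k zero)                 ≤⟨ length-chains k zero ⟩
  β 1                                    ∎
  where open ≤-Reasoning
length-zeroPrefixed k (suc s) = begin
  length (map bumpSecond (zeroPrefixed k s) ++ map prepend00 (chains k (suc s)))
    ≡⟨ length-map-++ bumpSecond (zeroPrefixed k s) _ ⟩
  length (zeroPrefixed k s) + length (map prepend00 (chains k (suc s)))
    ≡⟨ cong (length (zeroPrefixed k s) +_) (length-map prepend00 (chains k (suc s))) ⟩
  length (zeroPrefixed k s) + length (chains k (suc s))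
    ≤⟨ +-mono-≤ (length-zeroPrefixed k s) (length-chains k (suc s)) ⟩
  β (suc s) + (α (suc s) + β (suc s))
    ≡⟨ step (α (suc s)) (β (suc s)) ⟩
  β (suc (suc s)) ∎
  where
  open ≤-Reasoning
  step : ∀ a b → b + (a + b) ≡ a + 2 * b
  step = solve-∀

entry : List ℕ → ℕ → ℕ
entry []       _       = 0
entry (x ∷ xs) zero    = x
entry (x ∷ xs) (suc q) = entry xs q

-- double i is the position of the first entry of pair i; unlike 2 * i it
-- moves past one pair by computation.
double : ℕ → ℕ
double zero    = zero
double (suc i) = suc (suc (double i))

double≡2* : ∀ i → double i ≡ 2 * i
double≡2* zero    = refl
double≡2* (suc i) = trans (cong (λ t → suc (suc t)) (double≡2* i)) (sym (*-suc 2 i))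

-- Condition (iii) for a flat list of k pairs: if a pair other than the last
-- one vanishes, then so does everything after it.
ZeroPairStops : ℕ → List ℕ → Set
ZeroPairStops k w = ∀ i → 2 + i ≤ k →
  entry w (double i) ≡ 0 → entry w (suc (double i)) ≡ 0 →
  ∀ j → entry w (double (suc i) + j) ≡ 0

zeroPairStops-tail : ∀ {k a b r} → ZeroPairStops (suc k) (a ∷ b ∷ r) → ZeroPairStops k r
zeroPairStops-tail stops i 2+i≤k = stops (suc i) (s≤s 2+i≤k)

vanishing⇒zeros : ∀ k r → length r ≡ double k → (∀ q → entry r q ≡ 0) → r ≡ zeros k
vanishing⇒zeros zero    []            _   _   = refl
vanishing⇒zeros zero    (_ ∷ _)       ()  _
vanishing⇒zeros (suc k) []            ()  _
vanishing⇒zeros (suc k) (_ ∷ [])      ()  _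
vanishing⇒zeros (suc k) (x ∷ y ∷ r)   len vanish =
  cong₂ _∷_ (vanish 0) (cong₂ _∷_ (vanish 1)
    (vanishing⇒zeros k r (suc-injective (suc-injective len)) (λ q → vanish (2 + q))))

toChain : ∀ k w → length w ≡ double k → ZeroPairStops k w → Chain k w
toChain zero    []       refl _ = done
toChain zero    (_ ∷ _)  ()   _
toChain (suc k) []       ()   _
toChain (suc k) (_ ∷ []) ()   _
toChain (suc k) (suc a ∷ b ∷ r) len stops =
  left (toChain k r (suc-injective (suc-injective len)) (zeroPairStops-tail stops))
toChain (suc k) (zero ∷ suc b ∷ r) len stops =
  right (toChain k r (suc-injective (suc-injective len)) (zeroPairStops-tail stops))
toChain 1 (zero ∷ zero ∷ []) refl _ = stop
toChain 1 (zero ∷ zero ∷ _ ∷ _) () _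
toChain (suc (suc k)) (zero ∷ zero ∷ r) len stops
  -- pair 0 vanishes, so (as it is not the last pair) the whole tail does
  rewrite vanishing⇒zeros (suc k) r (suc-injective (suc-injective len))
            (stops 0 (s≤s (s≤s z≤n)) refl refl) = stop

-- The candidates for n = m + 1: a first entry x ≤ n followed by a chain of
-- m pairs with sum ≤ n.
candidates : ℕ → List (List ℕ)
candidates m = cartesianProductWith _∷_ (upTo (2 + m)) (chains m (suc m))

candidates-complete : ∀ m l → length l ≡ suc (double m) → sum l ≤ suc m →
                      ZeroPairStops m (drop 1 l) → l ∈ candidates m
candidates-complete m (x ∷ w) len sum≤ stops =
  cartesianProductWith⁺ _∷_ (cong₂ _∷_)
    (∈-upTo⁺ (s≤s (≤-trans (m≤m+n x (sum w)) sum≤)))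
    (chains-complete (toChain m w (suc-injective len) stops) (≤-trans (m≤n+m (sum w) x) sum≤))

length-candidates : ∀ m → length (candidates m) ≤ 4 * suc m * α (suc m)
length-candidates m = begin
  length (candidates m)
    ≡⟨ length-cartesianProductWith _∷_ (upTo (2 + m)) (chains m s) ⟩
  length (upTo (2 + m)) * length (chains m s)
    ≡⟨ cong (_* length (chains m s)) (length-upTo (2 + m)) ⟩
  (2 + m) * length (chains m s)
    ≤⟨ *-monoʳ-≤ (2 + m) (length-chains m s) ⟩
  (2 + m) * (α s + β s)
    ≤⟨ *-monoʳ-≤ (2 + m) (+-monoʳ-≤ (α s) (β≤α s)) ⟩
  (2 + m) * (α s + α s)
    ≤⟨ m≤m+n _ (m * (α s + α s)) ⟩
  (2 + m) * (α s + α s) + m * (α s + α s)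
    ≡⟨ normalise m (α s) ⟩
  4 * suc m * α s ∎
  where
  open ≤-Reasoning
  s : ℕ
  s = suc m
  normalise : ∀ m a → (2 + m) * (a + a) + m * (a + a) ≡ 4 * (1 + m) * a
  normalise = solve-∀

at≡entry : ∀ {d} (v : Vec ℕ d) p → at v (suc p) ≡ entry (toList v) p
at≡entry Vec.[]       p       = refl
at≡entry (x Vec.∷ v) zero    = refl
at≡entry (x Vec.∷ v) (suc p) = at≡entry v p

at≡entry-tail : ∀ {d} (v : Vec ℕ d) p → at v (suc (suc p)) ≡ entry (drop 1 (toList v)) p
at≡entry-tail Vec.[]      p = refl
at≡entry-tail (x Vec.∷ v) p = at≡entry v p

at-beyond : ∀ {d} (v : Vec ℕ d) j → d < j → at v j ≡ 0
at-beyond Vec.[]      j             _           = refl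
at-beyond (x Vec.∷ v) (suc (suc j)) (s≤s d<1+j) = at-beyond v (suc j) d<1+j

-- ZeroFrom only speaks about indices ≤ 2n-1; past them `at` is 0 anyway.
zeroFrom-everywhere : ∀ {n v a} → ZeroFrom n v a → ∀ j → a ≤ j → at v j ≡ 0
zeroFrom-everywhere {n} {v} zero-from j a≤j with j ≤? dim n
... | yes j≤dim = zero-from j a≤j j≤dim
... | no  j≰dim = at-beyond v j (≰⇒> j≰dim)

sum-toList : ∀ {d} (v : Vec ℕ d) → Vec.sum v ≡ sum (toList v)
sum-toList Vec.[]      = refl
sum-toList (x Vec.∷ v) = cong (x +_) (sum-toList v)

length-toList-dim : ∀ m (v : Vec ℕ (dim (suc m))) → length (toList v) ≡ suc (double m)
length-toList-dim m v =
  trans (VecProperties.length-toList v) (cong (_∸ 1) (sym (double≡2* (suc m))))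

-- Condition (iii) of Good, for the pairs after the first entry: pair i of
-- that list is (v_{2(i+1)}, v_{2(i+1)+1}), so instance i+1 of (iii) applies.
good⇒zeroPairStops : ∀ m (v : Vec ℕ (dim (suc m))) → Good (suc m) v →
                     ZeroPairStops m (drop 1 (toList v))
good⇒zeroPairStops (suc m) v (_ , _ , stops) i (s≤s i<m) first second j =
  begin
    entry (drop 1 (toList v)) (double (suc i) + j) ≡⟨ sym (at≡entry-tail v _) ⟩
    at v (suc (suc (double (suc i) + j)))
      ≡⟨ zeroFrom-everywhere {suc (suc m)} {v} tail-zero _ bound ⟩
    0                                              ∎
  where
  open ≡-Reasoning
  pair-first : 2 * suc i ≡ suc (suc (double i))
  pair-first = sym (double≡2* (suc i))
  pair-second : 2 * suc i + 1 ≡ suc (suc (suc (double i)))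
  pair-second = trans (cong (_+ 1) pair-first) (+-comm _ 1)
  tail-start : 2 * suc i + 2 ≡ suc (suc (double (suc i)))
  tail-start = trans (cong (_+ 2) (sym (double≡2* (suc i)))) (+-comm _ 2)
  tail-zero : ZeroFrom (suc (suc m)) v (2 * suc i + 2)
  tail-zero = stops (suc i) (s≤s z≤n) i<m
    (trans (cong (at v) pair-first) (trans (at≡entry-tail v _) first))
    (trans (cong (at v) pair-second) (trans (at≡entry-tail v _) second))
  bound : 2 * suc i + 2 ≤ suc (suc (double (suc i) + j))
  bound = subst (_≤ suc (suc (double (suc i) + j))) (sym tail-start)
                (s≤s (s≤s (m≤m+n _ j)))

good⇒candidate : ∀ m (v : Vec ℕ (dim (suc m))) → Good (suc m) v → toList v ∈ candidates m
good⇒candidate m v good@(sum≤ , _) =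
  candidates-complete m (toList v) (length-toList-dim m v)
    (subst (_≤ suc m) (sum-toList v) sum≤) (good⇒zeroPairStops m v good)

toList-injective : ∀ {d} {v w : Vec ℕ d} → toList v ≡ toList w → v ≡ w
toList-injective {v = v} {w} eq =
  trans (sym (VecProperties.cast-is-id refl v)) (VecProperties.toList-injective refl v w eq)

lemma2 : ∃ λ (C : ℕ) → ∃ λ (N : ℕ) → ∀ (n : ℕ) → N ≤ n →
    (L : List (Vec ℕ (dim n))) → Unique L → (∀ v → (v ∈ L) ⇔ Good n v) →
    ≤*pow2+√2 (length L) (C * n) n
lemma2 = 4 , 1 , bound
  where
  bound : ∀ n → 1 ≤ n → (L : List (Vec ℕ (dim n))) → Unique L →
          (∀ v → (v ∈ L) ⇔ Good n v) → ≤*pow2+√2 (length L) (4 * n) n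
  bound (suc m) _ L unique good⇔ =
    ≤*pow2+√2-from-α (length L) (4 * suc m) (suc m) (begin
    length L               ≡⟨ sym (length-map toList L) ⟩
    length (map toList L)  ≤⟨ unique-⊆⇒length≤ unique-lists ⊆candidates ⟩
    length (candidates m)  ≤⟨ length-candidates m ⟩
    4 * suc m * α (suc m)  ∎)
    where
    open ≤-Reasoning
    unique-lists : Unique (map toList L)
    unique-lists = Unique.map⁺ toList-injective unique
    ⊆candidates : ∀ {l} → l ∈ map toList L → l ∈ candidates m
    ⊆candidates l∈ with ∈-map⁻ toList l∈
    ... | v , v∈L , refl = good⇒candidate m v (Equivalence.to (good⇔ v) v∈L)
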